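{- Let $N$ be a rooted binary phylogenetic $X$-network and let $\mathcal{Z}=\{Z_1,\dots,Z_\ell\}$ be the decomposition of $N$ into maximal zig-zag trails (the unique decomposition of $N$ all of whose members are maximal zig-zag trails in $N$). Then a subset $S\subseteq A(N)$ is an admissible subset of $A(N)$ if and only if, for each $i\in[1,\ell]$, $S_i:=S\cap A(Z_i)$ is an admissible subset of $A(Z_i)$.
   Context: All digraphs are finite, simple and acyclic; for an arc $a=(u,v)$, ${\it tail}(a)=u$, ${\it head}(a)=v$; ${\it deg}^-_N,{\it deg}^+_N$ are in- and out-degree in $N$. A leaf is a vertex of in-degree $1$ and out-degree $0$. A rooted binary phylogenetic $X$-network ($X$ non-empty finite) is a finite simple acyclic digraph $N$ with a unique vertex $\rho$ of in-degree $0$, which has out-degree in $\{1,2\}$, whose leaf set is $X$, and in which every other vertex $v$ satisfies $\{{\it deg}^-_N(v),{\it deg}^+_N(v)\}=\{1,2\}$. For arcs $A'$ of $G$, $G[A']$ is the subgraph with arc set $A'$ and vertex set the endpoints of arcs of $A'$; for a partition $\{A_1,\dots,A_\ell\}$ of $A(G)$ into non-empty sets, $\{G[A_1],\dots,G[A_\ell]\}$ is a decomposition of $G$. A zig-zag trail in $N$ is a connected subgraph $Z$ with $|A(Z)|\ge1$ whose arcs admit an ordering $(a_1,\dots,a_m)$ with ${\it head}(a_i)={\it head}(a_{i+1})$ or ${\it tail}(a_i)={\it tail}(a_{i+1})$ for all $i\in[1,m-1]$; it is maximal if it is not a proper subgraph of another zig-zag trail in $N$. For a subgraph $Z$ of $N$,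 a subset $S\subseteq A(Z)$ is admissible if: (C0) $S$ contains every $(u,v)\in A(Z)$ with ${\it deg}^-_N(v)=1$ or ${\it deg}^+_N(u)=1$; (C1) for any two distinct $a_1,a_2\in A(Z)$ with ${\it head}(a_1)={\it head}(a_2)$, exactly one of $a_1,a_2$ is in $S$; (C2) for any two distinct $a_1,a_2\in A(Z)$ with ${\it tail}(a_1)={\it tail}(a_2)$, at least one of $a_1,a_2$ is in $S$. -}

module Defs where

open import Data.Nat using (ℕ; zero; suc; _+_; _≥_)
open import Data.Fin using (Fin; zero; suc)
open import Data.Bool using (Bool; true; false; _∧_; if_then_else_)
open import Data.Product using (Σ; ∃; ∃-syntax; _×_; _,_; proj₁; proj₂)
open import Data.Sum using (_⊎_)
open import Data.Unit using (⊤)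
open import Data.List using (List; []; _∷_; length)
open import Data.List.Membership.Propositional using (_∈_)
open import Data.List.Relation.Unary.Unique.Propositional using (Unique)
open import Relation.Binary.PropositionalEquality using (_≡_; _≢_)
open import Relation.Nullary using (¬_)
open import Function.Bundles using (_⇔_)

-- A finite simple digraph on vertex set Fin n, given by its adjacency
-- relation: G u v ≡ true iff (u , v) is an arc.  (No multi-arcs by
-- construction; loops are excluded by acyclicity.)
Digraph : ℕ → Set
Digraph n = Fin n → Fin n → Bool

-- A subgraph G[A'] is determined by
-- its arc set A' (its vertex set is the set of endpoints of arcs of A'),
-- so subgraphs spanned by arc sets are represented by their arc sets.
ArcSet : ℕ → Set
ArcSet = Digraph

Arc : ℕ → Set
Arc n = Fin n × Fin n

tail head : ∀ {n} → Arc n → Fin n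
tail = proj₁
head = proj₂

_∈A_ : ∀ {n} → Arc n → ArcSet n → Set
(u , v) ∈A S = S u v ≡ true

_⊆A_ : ∀ {n} → ArcSet n → ArcSet n → Set
S ⊆A T = ∀ a → a ∈A S → a ∈A T

_∩A_ : ∀ {n} → ArcSet n → ArcSet n → ArcSet n
(S ∩A T) u v = S u v ∧ T u v

_⊂A_ : ∀ {n} → ArcSet n → ArcSet n → Set
S ⊂A T = S ⊆A T × ∃[ a ] (a ∈A T × ¬ (a ∈A S))

count : ∀ {n} → (Fin n → Bool) → ℕ
count {zero} f = 0
count {suc n} f = (if f zero then 1 else 0) + count (λ i → f (suc i))

indeg outdeg : ∀ {n} → Digraph n → Fin n → ℕ
indeg G v = count (λ u → G u v)
outdeg G u = count (λ v → G u v)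

data Path⁺ {n} (G : Digraph n) : Fin n → Fin n → Set where
  arc  : ∀ {u v} → G u v ≡ true → Path⁺ G u v
  _▸_  : ∀ {u v w} → G u v ≡ true → Path⁺ G v w → Path⁺ G u w

Acyclic : ∀ {n} → Digraph n → Set
Acyclic G = ∀ v → ¬ Path⁺ G v v

IsLeaf : ∀ {n} → Digraph n → Fin n → Set
IsLeaf G v = indeg G v ≡ 1 × outdeg G v ≡ 0

record IsBinaryPhyloNetwork {n} (N : Digraph n) (X : Fin n → Bool) : Set where
  field
    acyclic      : Acyclic N
    X-nonempty   : ∃[ x ] (X x ≡ true)
    root         : Fin n
    root-indeg   : indeg N root ≡ 0
    root-outdeg  : outdeg N root ≡ 1 ⊎ outdeg N root ≡ 2
    root-unique  : ∀ v → indeg N v ≡ 0 → v ≡ root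
    leaves       : ∀ v → IsLeaf N v ⇔ (X v ≡ true)
    others       : ∀ v → v ≢ root → X v ≡ false →
                     (indeg N v ≡ 1 × outdeg N v ≡ 2) ⊎ (indeg N v ≡ 2 × outdeg N v ≡ 1)

ZigZagSeq : ∀ {n} → List (Arc n) → Set
ZigZagSeq [] = ⊤
ZigZagSeq (a ∷ []) = ⊤
ZigZagSeq (a ∷ b ∷ rest) = (head a ≡ head b ⊎ tail a ≡ tail b) × ZigZagSeq (b ∷ rest)

ShareEnd : ∀ {n} → Arc n → Arc n → Set
ShareEnd a b = head a ≡ head b ⊎ head a ≡ tail b ⊎ tail a ≡ head b ⊎ tail a ≡ tail b

data Linked {n} (Z : ArcSet n) : Arc n → Arc n → Set where
  here : ∀ {a} → a ∈A Z → Linked Z a a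
  next : ∀ {a b c} → Linked Z a b → c ∈A Z → ShareEnd b c → Linked Z a c

-- G[Z] is connected (as an undirected graph; its vertices are endpoints of arcs)
Connected : ∀ {n} → ArcSet n → Set
Connected Z = ∀ a b → a ∈A Z → b ∈A Z → Linked Z a b

IsZigZagTrail : ∀ {n} → Digraph n → ArcSet n → Set
IsZigZagTrail {n} N Z =
  Z ⊆A N × Connected Z ×
  Σ (List (Arc n)) λ as →
    Unique as × (∀ a → a ∈A Z ⇔ a ∈ as) × length as ≥ 1 × ZigZagSeq as

IsMaximalZigZagTrail : ∀ {n} → Digraph n → ArcSet n → Set
IsMaximalZigZagTrail N Z =
  IsZigZagTrail N Z × (∀ Z' → IsZigZagTrail N Z' → ¬ (Z ⊂A Z'))

IsDecomposition : ∀ {n ℓ} → Digraph n → (Fin ℓ → ArcSet n) → Set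
IsDecomposition {n} {ℓ} G Z =
  (∀ i → Z i ⊆A G) ×
  (∀ i → ∃[ a ] (a ∈A Z i)) ×
  (∀ a → a ∈A G → ∃[ i ] (a ∈A Z i)) ×
  (∀ a i j → a ∈A Z i → a ∈A Z j → i ≡ j)

Admissible : ∀ {n} → Digraph n → ArcSet n → ArcSet n → Set
Admissible N Z S =
  S ⊆A Z ×
  (∀ u v → (u , v) ∈A Z → (indeg N v ≡ 1 ⊎ outdeg N u ≡ 1) → (u , v) ∈A S) ×
  (∀ u₁ u₂ v → u₁ ≢ u₂ → (u₁ , v) ∈A Z → (u₂ , v) ∈A Z →
     ((u₁ , v) ∈A S × ¬ ((u₂ , v) ∈A S)) ⊎ (¬ ((u₁ , v) ∈A S) × (u₂ , v) ∈A S)) ×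
  (∀ u v₁ v₂ → v₁ ≢ v₂ → (u , v₁) ∈A Z → (u , v₂) ∈A Z →
     (u , v₁) ∈A S ⊎ (u , v₂) ∈A S)

-- Every vertex of a binary network has in- and out-degree at most 2, so an arc
-- shares its head with at most one other arc and its tail with at most one
-- other arc.  For an arc strictly inside a zig-zag sequence these neighbours
-- are its predecessor and successor, so an arc of N outside the sequence that
-- shares a head or a tail with one of its arcs can be attached at an end.
-- Hence a maximal zig-zag trail contains every arc of N that shares a head or
-- a tail with one of its arcs.  Since (C0)-(C2) only relate arcs with a common
-- head or a common tail, admissibility can be checked trail by trail.
module Submission where

open import Defs
open import Data.Nat using (ℕ; _≤_; z≤n; s≤s)
open import Data.Nat.Properties using (≤-trans; ≤-reflexive)
open import Data.Fin using (Fin; zero; suc)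
open import Data.Fin.Properties using () renaming (_≟_ to _≟ᶠ_)
open import Data.Fin.Subset using (Subset; ∣_∣) renaming (_∈_ to _∈ˢ_)
open import Data.Fin.Subset.Properties using (x∈p∧x≢y⇒x∈p-y; x∈p⇒∣p-x∣<∣p∣)
open import Data.Bool using (Bool; true; false; _∧_; _∨_) renaming (_≟_ to _≟ᵇ_)
open import Data.Bool.Properties using (∧-conicalˡ; ∧-conicalʳ; ∨-zeroʳ)
open import Data.Vec using (tabulate)
open import Data.Vec.Properties using (lookup⇒[]=; lookup∘tabulate)
open import Data.Product as Product using (∃-syntax; _×_; _,_; proj₁; proj₂)
open import Data.Product.Properties using (≡-dec)
open import Data.Sum as Sum using (_⊎_; inj₁; inj₂)
open import Data.Unit using (tt)
open import Data.Empty using (⊥; ⊥-elim)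
open import Data.List using (List; []; _∷_; length; _∷ʳ_)
open import Data.List.Membership.Propositional using (_∈_; _∉_)
open import Data.List.Relation.Unary.Any using (here; there)
open import Data.List.Relation.Unary.All as All using (All; []; _∷_)
open import Data.List.Relation.Unary.All.Properties using (¬Any⇒All¬)
open import Data.List.Relation.Unary.AllPairs using ([]; _∷_)
open import Data.List.Relation.Unary.Unique.Propositional using (Unique)
open import Data.List.Relation.Binary.Permutation.Propositional using (_↭_; ↭-refl; ↭-sym; ↭⇒↭ₛ)
open import Data.List.Relation.Binary.Permutation.Propositional.Properties using (∈-resp-↭; ↭-length; ∷↭∷ʳ)
import Data.List.Relation.Binary.Permutation.Setoid.Properties as Setoid↭
open import Relation.Binary.PropositionalEquality using (_≡_; _≢_; refl; sym; trans; cong; cong₂; ≢-sym; setoid)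
open import Relation.Nullary using (¬_; Dec; yes; no; does)
open import Relation.Nullary.Decidable using (dec-true)
open import Function using (_∘_)
open import Function.Bundles using (_⇔_; mk⇔; Equivalence)

private
  variable
    n : ℕ

count≡∣tabulate∣ : ∀ {n} (f : Fin n → Bool) → count f ≡ ∣ tabulate f ∣
count≡∣tabulate∣ {ℕ.zero} f = refl
count≡∣tabulate∣ {ℕ.suc n} f with f zero
... | true  = cong ℕ.suc (count≡∣tabulate∣ (f ∘ suc))
... | false = count≡∣tabulate∣ (f ∘ suc)

length≤∣p∣ : {xs : List (Fin n)} {p : Subset n} → Unique xs → All (_∈ˢ p) xs → length xs ≤ ∣ p ∣
length≤∣p∣ [] [] = z≤n
length≤∣p∣ (x∉xs ∷ unique) (x∈p ∷ xs⊆p) =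
  ≤-trans (s≤s (length≤∣p∣ unique (All.zipWith (λ (y∈p , x≢y) → x∈p∧x≢y⇒x∈p-y y∈p (≢-sym x≢y)) (xs⊆p , x∉xs))))
          (x∈p⇒∣p-x∣<∣p∣ x∈p)

length≤count : (f : Fin n → Bool) {xs : List (Fin n)} → Unique xs → All (λ x → f x ≡ true) xs → length xs ≤ count f
length≤count f unique holds =
  ≤-trans (length≤∣p∣ unique (All.map (λ {x} fx → lookup⇒[]= x (tabulate f) (trans (lookup∘tabulate f x) fx)) holds))
          (≤-reflexive (sym (count≡∣tabulate∣ f)))

DegreeAtMost2 : Digraph n → Set
DegreeAtMost2 N = ∀ v → indeg N v ≤ 2 × outdeg N v ≤ 2

module _ {N : Digraph n} {X : Fin n → Bool} (net : IsBinaryPhyloNetwork N X) where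
  open IsBinaryPhyloNetwork net

  binary⇒degreeAtMost2 : DegreeAtMost2 N
  binary⇒degreeAtMost2 v with v ≟ᶠ root
  ... | yes refl = ≤-trans (≤-reflexive root-indeg) z≤n , root-outdeg≤2 root-outdeg
    where
      root-outdeg≤2 : outdeg N root ≡ 1 ⊎ outdeg N root ≡ 2 → outdeg N root ≤ 2
      root-outdeg≤2 (inj₁ one) = ≤-trans (≤-reflexive one) (s≤s z≤n)
      root-outdeg≤2 (inj₂ two) = ≤-reflexive two
  ... | no v≢root with X v in v∈X
  ...   | true  = let (in-one , out-zero) = Equivalence.from (leaves v) v∈X
                  in ≤-trans (≤-reflexive in-one) (s≤s z≤n) , ≤-trans (≤-reflexive out-zero) z≤n
  ...   | false with others v v≢root v∈X
  ...     | inj₁ (in-one , out-two) = ≤-trans (≤-reflexive in-one) (s≤s z≤n) , ≤-reflexive out-two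
  ...     | inj₂ (in-two , out-one) = ≤-reflexive in-two , ≤-trans (≤-reflexive out-one) (s≤s z≤n)

ZigZagStep : Arc n → Arc n → Set
ZigZagStep a b = head a ≡ head b ⊎ tail a ≡ tail b

ZigZagStep-sym : {a b : Arc n} → ZigZagStep a b → ZigZagStep b a
ZigZagStep-sym (inj₁ same-head) = inj₁ (sym same-head)
ZigZagStep-sym (inj₂ same-tail) = inj₂ (sym same-tail)

ZigZagStep⇒ShareEnd : {a b : Arc n} → ZigZagStep a b → ShareEnd a b
ZigZagStep⇒ShareEnd (inj₁ same-head) = inj₁ same-head
ZigZagStep⇒ShareEnd (inj₂ same-tail) = inj₂ (inj₂ (inj₂ same-tail))

ZigZagSeq-∷ʳ : ∀ {a b : Arc n} as → ZigZagSeq (as ∷ʳ a) → ZigZagStep a b → ZigZagSeq (as ∷ʳ a ∷ʳ b)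
ZigZagSeq-∷ʳ []           _              a~b = a~b , tt
ZigZagSeq-∷ʳ (x ∷ [])     (x~a , _)      a~b = x~a , a~b , tt
ZigZagSeq-∷ʳ (x ∷ y ∷ as) (x~y , zigzag) a~b = x~y , ZigZagSeq-∷ʳ (y ∷ as) zigzag a~b

ShareEnd-sym : {a b : Arc n} → ShareEnd a b → ShareEnd b a
ShareEnd-sym (inj₁ hh)               = inj₁ (sym hh)
ShareEnd-sym (inj₂ (inj₁ ht))        = inj₂ (inj₂ (inj₁ (sym ht)))
ShareEnd-sym (inj₂ (inj₂ (inj₁ th))) = inj₂ (inj₁ (sym th))
ShareEnd-sym (inj₂ (inj₂ (inj₂ tt′))) = inj₂ (inj₂ (inj₂ (sym tt′)))

Linked-mono : {Z Z′ : ArcSet n} {a b : Arc n} → Z ⊆A Z′ → Linked Z a b → Linked Z′ a b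
Linked-mono Z⊆Z′ (here a∈Z)         = here (Z⊆Z′ _ a∈Z)
Linked-mono Z⊆Z′ (next l c∈Z b-c)   = next (Linked-mono Z⊆Z′ l) (Z⊆Z′ _ c∈Z) b-c

Linked-∷ : {Z : ArcSet n} {a b c : Arc n} → a ∈A Z → ShareEnd a b → Linked Z b c → Linked Z a c
Linked-∷ a∈Z a-b (here b∈Z)        = next (here a∈Z) b∈Z a-b
Linked-∷ a∈Z a-b (next l d∈Z c-d)  = next (Linked-∷ a∈Z a-b l) d∈Z c-d

_≟ₐ_ : (a b : Arc n) → Dec (a ≡ b)
_≟ₐ_ = ≡-dec _≟ᶠ_ _≟ᶠ_

insert : Arc n → ArcSet n → ArcSet n
insert b Z u v = does ((u , v) ≟ₐ b) ∨ Z u v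

∈-insert⁺ˡ : (b : Arc n) (Z : ArcSet n) → b ∈A insert b Z
∈-insert⁺ˡ b Z = cong (_∨ _) (dec-true (_ ≟ₐ b) refl)

∈-insert⁺ʳ : (b : Arc n) (Z : ArcSet n) → Z ⊆A insert b Z
∈-insert⁺ʳ b Z a a∈Z = trans (cong (_ ∨_) a∈Z) (∨-zeroʳ _)

∈-insert⁻ : (b : Arc n) (Z : ArcSet n) (a : Arc n) → a ∈A insert b Z → a ≡ b ⊎ a ∈A Z
∈-insert⁻ b Z a a∈ with (proj₁ a , proj₂ a) ≟ₐ b
... | yes a≡b = inj₁ a≡b
... | no  _   = inj₂ a∈

Connected-insert : {Z : ArcSet n} {a b : Arc n} → Connected Z → a ∈A Z → ShareEnd a b → Connected (insert b Z)
Connected-insert {Z = Z} {a} {b} connected a∈Z a-b x y x∈ y∈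
  with ∈-insert⁻ b Z x x∈ | ∈-insert⁻ b Z y y∈
... | inj₁ refl | inj₁ refl = here x∈
... | inj₁ refl | inj₂ y∈Z  = Linked-∷ x∈ (ShareEnd-sym a-b) (Linked-mono (∈-insert⁺ʳ b Z) (connected a y a∈Z y∈Z))
... | inj₂ x∈Z  | inj₁ refl = next (Linked-mono (∈-insert⁺ʳ b Z) (connected x a x∈Z a∈Z)) y∈ a-b
... | inj₂ x∈Z  | inj₂ y∈Z  = Linked-mono (∈-insert⁺ʳ b Z) (connected x y x∈Z y∈Z)

Enumerates : ArcSet n → List (Arc n) → Set
Enumerates Z as = Unique as × (∀ a → a ∈A Z ⇔ a ∈ as)

Enumerates-insert : {Z : ArcSet n} {as : List (Arc n)} {b : Arc n} →
                    Enumerates Z as → b ∉ as → Enumerates (insert b Z) (b ∷ as)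
Enumerates-insert {Z = Z} {as} {b} (unique , members) b∉as =
  ¬Any⇒All¬ as b∉as ∷ unique , λ a → mk⇔ (to a) (from a)
  where
    to : ∀ a → a ∈A insert b Z → a ∈ b ∷ as
    to a a∈ with ∈-insert⁻ b Z a a∈
    ... | inj₁ a≡b = here a≡b
    ... | inj₂ a∈Z = there (Equivalence.to (members a) a∈Z)
    from : ∀ a → a ∈ b ∷ as → a ∈A insert b Z
    from a (here refl)    = ∈-insert⁺ˡ b Z
    from a (there a∈as)   = ∈-insert⁺ʳ b Z a (Equivalence.from (members a) a∈as)

Enumerates-resp-↭ : {Z : ArcSet n} {as cs : List (Arc n)} → Enumerates Z as → as ↭ cs → Enumerates Z cs
Enumerates-resp-↭ {n = n} (unique , members) as↭cs =
  Setoid↭.Unique-resp-↭ (setoid (Arc n)) (↭⇒↭ₛ as↭cs) unique ,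
  λ a → mk⇔ (∈-resp-↭ as↭cs ∘ Equivalence.to (members a)) (Equivalence.from (members a) ∘ ∈-resp-↭ (↭-sym as↭cs))

ZigZagClosed : Digraph n → ArcSet n → Set
ZigZagClosed N Z = ∀ {a b} → a ∈A Z → b ∈A N → ZigZagStep a b → b ∈A Z

3≰2 : ¬ (3 ≤ 2)
3≰2 (s≤s (s≤s ()))

module _ {N : Digraph n} (deg : DegreeAtMost2 N) where

  no-three-in-neighbours : ∀ {u₁ u₂ u₃ v} → N u₁ v ≡ true → N u₂ v ≡ true → N u₃ v ≡ true →
                           u₁ ≢ u₂ → u₁ ≢ u₃ → u₂ ≢ u₃ → ⊥
  no-three-in-neighbours {u₁} {u₂} {u₃} {v} e₁ e₂ e₃ u₁≢u₂ u₁≢u₃ u₂≢u₃ =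
    3≰2 (≤-trans (length≤count (λ u → N u v) distinct (e₁ ∷ e₂ ∷ e₃ ∷ [])) (proj₁ (deg v)))
    where
      distinct : Unique (u₁ ∷ u₂ ∷ u₃ ∷ [])
      distinct = (u₁≢u₂ ∷ u₁≢u₃ ∷ []) ∷ (u₂≢u₃ ∷ []) ∷ [] ∷ []

  no-three-out-neighbours : ∀ {u v₁ v₂ v₃} → N u v₁ ≡ true → N u v₂ ≡ true → N u v₃ ≡ true →
                            v₁ ≢ v₂ → v₁ ≢ v₃ → v₂ ≢ v₃ → ⊥
  no-three-out-neighbours {u} {v₁} {v₂} {v₃} e₁ e₂ e₃ v₁≢v₂ v₁≢v₃ v₂≢v₃ =
    3≰2 (≤-trans (length≤count (N u) distinct (e₁ ∷ e₂ ∷ e₃ ∷ [])) (proj₂ (deg u)))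
    where
      distinct : Unique (v₁ ∷ v₂ ∷ v₃ ∷ [])
      distinct = (v₁≢v₂ ∷ v₁≢v₃ ∷ []) ∷ (v₂≢v₃ ∷ []) ∷ [] ∷ []

  no-three-arcs-share-head : ∀ {a p q : Arc n} → a ∈A N → p ∈A N → q ∈A N →
                             a ≢ p → a ≢ q → p ≢ q → head a ≡ head p → head a ≡ head q → ⊥
  no-three-arcs-share-head {a = _ , v} {_ , _} {_ , _} a∈N p∈N q∈N a≢p a≢q p≢q refl refl =
    no-three-in-neighbours a∈N p∈N q∈N (a≢p ∘ cong (_, v)) (a≢q ∘ cong (_, v)) (p≢q ∘ cong (_, v))

  no-three-arcs-share-tail : ∀ {a p q : Arc n} → a ∈A N → p ∈A N → q ∈A N →
                             a ≢ p → a ≢ q → p ≢ q → tail a ≡ tail p → tail a ≡ tail q → ⊥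
  no-three-arcs-share-tail {a = u , _} {_ , _} {_ , _} a∈N p∈N q∈N a≢p a≢q p≢q refl refl =
    no-three-out-neighbours a∈N p∈N q∈N (a≢p ∘ cong (u ,_)) (a≢q ∘ cong (u ,_)) (p≢q ∘ cong (u ,_))

  no-three-zigzag-neighbours : ∀ {a x y z : Arc n} → a ∈A N → x ∈A N → y ∈A N → z ∈A N →
    a ≢ x → a ≢ y → a ≢ z → x ≢ y → x ≢ z → y ≢ z →
    ZigZagStep a x → ZigZagStep a y → ZigZagStep a z → ⊥
  no-three-zigzag-neighbours {a} {x} {y} {z} a∈N x∈N y∈N z∈N a≢x a≢y a≢z x≢y x≢z y≢z = go
    where
      go : ZigZagStep a x → ZigZagStep a y → ZigZagStep a z → ⊥
      go (inj₁ hx) (inj₁ hy) _         = no-three-arcs-share-head a∈N x∈N y∈N a≢x a≢y x≢y hx hy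
      go (inj₁ hx) _         (inj₁ hz) = no-three-arcs-share-head a∈N x∈N z∈N a≢x a≢z x≢z hx hz
      go _         (inj₁ hy) (inj₁ hz) = no-three-arcs-share-head a∈N y∈N z∈N a≢y a≢z y≢z hy hz
      go (inj₂ tx) (inj₂ ty) _         = no-three-arcs-share-tail a∈N x∈N y∈N a≢x a≢y x≢y tx ty
      go (inj₂ tx) _         (inj₂ tz) = no-three-arcs-share-tail a∈N x∈N z∈N a≢x a≢z x≢z tx tz
      go _         (inj₂ ty) (inj₂ tz) = no-three-arcs-share-tail a∈N y∈N z∈N a≢y a≢z y≢z ty tz

  module _ {a b : Arc n} (b∈N : b ∈A N) (a~b : ZigZagStep a b) where

    outside-neighbour⇒endpoint : ∀ as → ZigZagSeq as → Unique as → All (_∈A N) as → a ∈ as → b ∉ as →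
                                 (∃[ r ] as ≡ a ∷ r) ⊎ (∃[ r ] as ≡ r ∷ʳ a)
    outside-neighbour⇒endpoint (_ ∷ r) _ _ _ (here refl) _ = inj₁ (r , refl)
    outside-neighbour⇒endpoint (x ∷ y ∷ r) (_ , zigzag) (_ ∷ unique) (_ ∷ all∈N) (there a∈as) b∉
      with outside-neighbour⇒endpoint (y ∷ r) zigzag unique all∈N a∈as (b∉ ∘ there)
    ... | inj₂ (r′ , eq) = inj₂ (x ∷ r′ , cong (x ∷_) eq)
    ... | inj₁ ([] , eq) = inj₂ (x ∷ [] , cong (x ∷_) eq)
    outside-neighbour⇒endpoint (x ∷ _ ∷ _) (x~a , a~z , _) ((x≢a ∷ x≢z ∷ _) ∷ (a≢z ∷ _) ∷ _)
                               (x∈N ∷ a∈N ∷ z∈N ∷ _) (there _) b∉ | inj₁ (z ∷ _ , refl) =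
      ⊥-elim (no-three-zigzag-neighbours a∈N x∈N z∈N b∈N (≢-sym x≢a) a≢z (b∉ ∘ there ∘ here ∘ sym)
                x≢z (b∉ ∘ here ∘ sym) (b∉ ∘ there ∘ there ∘ here ∘ sym) (ZigZagStep-sym x~a) a~z a~b)

    zigzag-extend : ∀ {as} → ZigZagSeq as → Unique as → All (_∈A N) as → a ∈ as → b ∉ as →
                    ∃[ cs ] (b ∷ as ↭ cs × ZigZagSeq cs)
    zigzag-extend {as} zigzag unique all∈N a∈as b∉as
      with outside-neighbour⇒endpoint as zigzag unique all∈N a∈as b∉as
    ... | inj₁ (r , refl) = b ∷ a ∷ r , ↭-refl , ZigZagStep-sym a~b , zigzag
    ... | inj₂ (r , refl) = r ∷ʳ a ∷ʳ b , ∷↭∷ʳ b (r ∷ʳ a) , ZigZagSeq-∷ʳ r zigzag a~b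

  insert-isZigZagTrail : {Z : ArcSet n} {a b : Arc n} → IsZigZagTrail N Z →
                         b ∈A N → a ∈A Z → ZigZagStep a b → ¬ b ∈A Z → IsZigZagTrail N (insert b Z)
  insert-isZigZagTrail {Z = Z} {a} {b} (Z⊆N , connected , as , unique , members , _ , zigzag) b∈N a∈Z a~b b∉Z
    with zigzag-extend b∈N a~b zigzag unique (All.tabulate (λ {x} → Z⊆N x ∘ Equivalence.from (members x)))
                       (Equivalence.to (members a) a∈Z) (b∉Z ∘ Equivalence.from (members b))
  ... | cs , b∷as↭cs , zigzag′ =
    insert⊆N , Connected-insert connected a∈Z (ZigZagStep⇒ShareEnd a~b) ,
    cs , proj₁ enumerates , proj₂ enumerates , ≤-trans (s≤s z≤n) (≤-reflexive (↭-length b∷as↭cs)) , zigzag′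
    where
      insert⊆N : insert b Z ⊆A N
      insert⊆N x x∈ with ∈-insert⁻ b Z x x∈
      ... | inj₁ refl = b∈N
      ... | inj₂ x∈Z  = Z⊆N x x∈Z
      enumerates : Enumerates (insert b Z) cs
      enumerates = Enumerates-resp-↭ (Enumerates-insert (unique , members) (b∉Z ∘ Equivalence.from (members b))) b∷as↭cs

  maximal⇒zigzagClosed : {Z : ArcSet n} → IsMaximalZigZagTrail N Z → ZigZagClosed N Z
  maximal⇒zigzagClosed {Z = Z} (trail , maximal) {a} {b} a∈Z b∈N a~b with Z (tail b) (head b) ≟ᵇ true
  ... | yes b∈Z = b∈Z
  ... | no  b∉Z = ⊥-elim (maximal (insert b Z) (insert-isZigZagTrail trail b∈N a∈Z a~b b∉Z)
                                  (∈-insert⁺ʳ b Z , b , ∈-insert⁺ˡ b Z , b∉Z))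

∈-∩⁺ : (S T : ArcSet n) {u v : Fin n} → (u , v) ∈A S → (u , v) ∈A T → (u , v) ∈A (S ∩A T)
∈-∩⁺ _ _ = cong₂ _∧_

∈-∩⁻ˡ : (S T : ArcSet n) {u v : Fin n} → (u , v) ∈A (S ∩A T) → (u , v) ∈A S
∈-∩⁻ˡ _ _ = ∧-conicalˡ _ _

∈-∩⁻ʳ : (S T : ArcSet n) {u v : Fin n} → (u , v) ∈A (S ∩A T) → (u , v) ∈A T
∈-∩⁻ʳ _ _ = ∧-conicalʳ _ _

Admissible-restrict : {N : Digraph n} {Z Z′ S : ArcSet n} → Z′ ⊆A Z → Admissible N Z S → Admissible N Z′ (S ∩A Z′)
Admissible-restrict {Z′ = Z′} {S} Z′⊆Z (_ , c0 , c1 , c2) =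
    (λ _ → ∈-∩⁻ʳ S Z′)
  , (λ u v e∈Z′ deg≡1 → ∈-∩⁺ S Z′ (c0 u v (Z′⊆Z _ e∈Z′) deg≡1) e∈Z′)
  , (λ u₁ u₂ v u₁≢u₂ e₁∈Z′ e₂∈Z′ →
       Sum.map (Product.map (λ s₁ → ∈-∩⁺ S Z′ s₁ e₁∈Z′) (_∘ ∈-∩⁻ˡ S Z′))
               (Product.map (_∘ ∈-∩⁻ˡ S Z′) (λ s₂ → ∈-∩⁺ S Z′ s₂ e₂∈Z′))
               (c1 u₁ u₂ v u₁≢u₂ (Z′⊆Z _ e₁∈Z′) (Z′⊆Z _ e₂∈Z′)))
  , (λ u v₁ v₂ v₁≢v₂ e₁∈Z′ e₂∈Z′ →
       Sum.map (λ s₁ → ∈-∩⁺ S Z′ s₁ e₁∈Z′) (λ s₂ → ∈-∩⁺ S Z′ s₂ e₂∈Z′)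
               (c2 u v₁ v₂ v₁≢v₂ (Z′⊆Z _ e₁∈Z′) (Z′⊆Z _ e₂∈Z′)))

Admissible-glue : {N : Digraph n} {ℓ : ℕ} {Z : Fin ℓ → ArcSet n} {S : ArcSet n} →
                  (∀ a → a ∈A N → ∃[ i ] a ∈A Z i) → (∀ i → ZigZagClosed N (Z i)) → S ⊆A N →
                  (∀ i → Admissible N (Z i) (S ∩A Z i)) → Admissible N N S
Admissible-glue {Z = Z} {S} covers closed S⊆N admissible =
    S⊆N
  , (λ u v e∈N deg≡1 →
       let (i , e∈Zᵢ) = covers _ e∈N ; (_ , c0 , _ , _) = admissible i
       in ∈-∩⁻ˡ S (Z i) (c0 u v e∈Zᵢ deg≡1))
  , (λ u₁ u₂ v u₁≢u₂ e₁∈N e₂∈N →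
       let (i , e₁∈Zᵢ) = covers _ e₁∈N ; (_ , _ , c1 , _) = admissible i
           e₂∈Zᵢ = closed i e₁∈Zᵢ e₂∈N (inj₁ refl)
       in Sum.map (Product.map (∈-∩⁻ˡ S (Z i)) (λ s₂∉ s₂ → s₂∉ (∈-∩⁺ S (Z i) s₂ e₂∈Zᵢ)))
                  (Product.map (λ s₁∉ s₁ → s₁∉ (∈-∩⁺ S (Z i) s₁ e₁∈Zᵢ)) (∈-∩⁻ˡ S (Z i)))
                  (c1 u₁ u₂ v u₁≢u₂ e₁∈Zᵢ e₂∈Zᵢ))
  , (λ u v₁ v₂ v₁≢v₂ e₁∈N e₂∈N →
       let (i , e₁∈Zᵢ) = covers _ e₁∈N ; (_ , _ , _ , c2) = admissible i
       in Sum.map (∈-∩⁻ˡ S (Z i)) (∈-∩⁻ˡ S (Z i)) (c2 u v₁ v₂ v₁≢v₂ e₁∈Zᵢ (closed i e₁∈Zᵢ e₂∈N (inj₂ refl))))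

lemma4p3 : ∀ {n} (N : Digraph n) (X : Fin n → Bool) → IsBinaryPhyloNetwork N X →
           ∀ (ℓ : ℕ) (Z : Fin ℓ → ArcSet n) → IsDecomposition N Z →
           (∀ i → IsMaximalZigZagTrail N (Z i)) →
           ∀ (S : ArcSet n) → S ⊆A N →
           (Admissible N N S ⇔ (∀ i → Admissible N (Z i) (S ∩A Z i)))
lemma4p3 N X net ℓ Z (Z⊆N , _ , covers , _) maximal S S⊆N =
  mk⇔ (λ admissible i → Admissible-restrict (Z⊆N i) admissible)
      (Admissible-glue covers (maximal⇒zigzagClosed (binary⇒degreeAtMost2 net) ∘ maximal) S⊆N)
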